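{- Let $J\subseteq C(n,2)$ be a realizable $2$-set, define $L^i,M^i$ as below, and let $2\le i\le n-1$. Then there is no $Y\in C(n,i+2)$ whose $(i+1)$-packet $P_Y$ is the union of the three nonempty sets $A=P_Y\cap(L^i_p\cap M^i_F)$, $B=P_Y\cap(L^i_\emptyset\cap M^i_F)$, $C=P_Y\cap(L^i_\emptyset\cap M^i_p)$ with $A<B<C$ (every element of $A$ lexicographically below every element of $B$, and every element of $B$ below every element of $C$).
   Context: $C(n,m)$: $m$-subsets of $\{1,\dots,n\}$ with lexicographic order on increasing sequences. For $X\in C(n,m+1)$, $P_X=\{Y\in C(n,m):Y\subset X\}$ with induced lexicographic order; prefix/suffix = initial/final segment. For $A\subseteq C(n,m)$ define subsets of $C(n,m+1)$: $A_p$ (resp. $A_s$) = $\{X:P_X\cap A$ a nonempty prefix (resp. suffix) of $P_X$ different from $P_X\}$, $A_F=\{X:P_X\subseteq A\}$, $A_\emptyset=\{X:P_X\cap A=\emptyset\}$. $A$ is realizable if $P_X\cap A$ is a prefix or suffix of $P_X$ for all $X$. Given realizable $J\subseteq C(n,2)$: $L^2=\emptyset$, $M^2=J$, and for $i\ge3$, $L^i=(M^{i-1})_s$, $M^i=(M^{i-1})_s\cup(M^{i-1}\setminus L^{i-1})_F$ (subsets of $C(n,i)$). -}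

module Defs where

open import Data.Nat using (ℕ; zero; suc; _<_; _≤_; _+_; _∸_)
open import Data.Bool using (Bool; true; false)
open import Data.Fin using (Fin)
open import Data.List using (List; []; _∷_; length; removeAt)
open import Data.List.Relation.Unary.All using (All)
open import Data.List.Relation.Unary.Linked using (Linked)
open import Data.Product using (Σ; ∃; _×_; _,_; proj₁; proj₂)
open import Data.Sum using (_⊎_)
open import Data.Empty using (⊥)
open import Relation.Nullary using (¬_)
open import Relation.Binary.PropositionalEquality using (_≡_)

-- m-subsets of {1,…,n} are represented as strictly increasing lists.
Comb : ℕ → ℕ → List ℕ → Set
Comb n m X = Linked _<_ X × All (λ x → 1 ≤ x × x ≤ n) X × length X ≡ m

SubsetC : Set₁
SubsetC = List ℕ → Set

data _<ₗ_ : List ℕ → List ℕ → Set where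
  here  : ∀ {x y xs ys} → x < y → (x ∷ xs) <ₗ (y ∷ ys)
  there : ∀ {x xs ys} → xs <ₗ ys → (x ∷ xs) <ₗ (x ∷ ys)

InPacket : List ℕ → List ℕ → Set
InPacket X Y = Σ (Fin (length X)) (λ k → Y ≡ removeAt X k)

-- P_X ∩ A is a prefix (initial segment) of P_X (possibly empty or all of P_X)
IsPrefix : SubsetC → List ℕ → Set
IsPrefix A X = ∀ Y Z → InPacket X Y → InPacket X Z → Y <ₗ Z → A Z → A Y

IsSuffix : SubsetC → List ℕ → Set
IsSuffix A X = ∀ Y Z → InPacket X Y → InPacket X Z → Y <ₗ Z → A Y → A Z

MeetsPacket : SubsetC → List ℕ → Set
MeetsPacket A X = ∃ λ Y → InPacket X Y × A Y

NotFullPacket : SubsetC → List ℕ → Set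
NotFullPacket A X = ∃ λ Y → InPacket X Y × ¬ A Y

_ₚ[_,_] : SubsetC → ℕ → ℕ → SubsetC
(A ₚ[ n , m ]) X = Comb n (suc m) X × MeetsPacket A X × NotFullPacket A X × IsPrefix A X

_ₛ[_,_] : SubsetC → ℕ → ℕ → SubsetC
(A ₛ[ n , m ]) X = Comb n (suc m) X × MeetsPacket A X × NotFullPacket A X × IsSuffix A X

_F[_,_] : SubsetC → ℕ → ℕ → SubsetC
(A F[ n , m ]) X = Comb n (suc m) X × (∀ Y → InPacket X Y → A Y)

_∅[_,_] : SubsetC → ℕ → ℕ → SubsetC
(A ∅[ n , m ]) X = Comb n (suc m) X × (∀ Y → InPacket X Y → ¬ A Y)

-- J ⊆ C(n,2) given by a characteristic function (restricted to C(n,2))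
JSet : ℕ → (List ℕ → Bool) → SubsetC
JSet n J Y = Comb n 2 Y × J Y ≡ true

Realizable : ℕ → (List ℕ → Bool) → Set
Realizable n J = ∀ X → Comb n 3 X → IsPrefix (JSet n J) X ⊎ IsSuffix (JSet n J) X

-- (L^{k+2}, M^{k+2}), subsets of C(n,k+2)
LM : ℕ → (List ℕ → Bool) → ℕ → SubsetC × SubsetC
LM n J zero = (λ _ → ⊥) , JSet n J
LM n J (suc k) = step (proj₁ (LM n J k)) (proj₂ (LM n J k))
  where
  step : SubsetC → SubsetC → SubsetC × SubsetC
  step L M = (M ₛ[ n , k + 2 ])
           , (λ X → (M ₛ[ n , k + 2 ]) X
                                 ⊎ ((λ Y → M Y × ¬ L Y) F[ n , k + 2 ]) X)

Lˢ : ℕ → (List ℕ → Bool) → ℕ → SubsetC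
Lˢ n J i = proj₁ (LM n J (i ∸ 2))

Mˢ : ℕ → (List ℕ → Bool) → ℕ → SubsetC
Mˢ n J i = proj₂ (LM n J (i ∸ 2))

{-# OPTIONS --safe #-}
module Submission where

-- Call a pair bad if it does not lie in J. Realizability of J says exactly that J and its
-- complement are transitive on triples. The kind of an increasing sequence is full if none of
-- its consecutive pairs is bad, and otherwise the parity of the position of its last bad
-- consecutive pair. Transitivity makes the kinds along a packet P_X, in lexicographic order,
-- run monotonically through kind X, then full, then the opposite parity. By induction on m
-- this identifies L^m with the m-sets of kind parity m and M^m with those of kind parity m or
-- full. In the situation of the lemma the members of A and of C therefore have kind parity i
-- while those of B are full, so along P_Y the kind would leave parity i for full and come back,
-- which the monotonicity forbids.

open import Defs
open import Data.Nat using (ℕ; zero; suc; _≤_; _<_; _∸_; _+_; z≤n; s≤s; pred)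
open import Data.Nat.Properties using (<-trans; <-irrefl; <-asym; ≤-refl; +-comm; m≤m+n)
open import Data.Bool using (Bool; true; false)
open import Data.Fin as Fin using (Fin; zero; suc)
open import Data.Fin.Properties using (<-cmp)
open import Data.List using (List; []; _∷_; length; removeAt)
open import Data.List.Properties using (length-removeAt)
open import Data.List.Relation.Unary.All using (All; []; _∷_)
open import Data.List.Relation.Unary.Linked as Linked using (Linked; []; [-]; _∷_)
open import Data.Product using (∃; _×_; _,_; proj₁; proj₂; map₂)
open import Data.Sum using (_⊎_; inj₁; inj₂; [_,_]′)
open import Data.Empty using (⊥-elim)
open import Function using (_∘_)
open import Function.Bundles using (_⇔_; mk⇔; Equivalence)
open import Relation.Nullary using (¬_; contradiction)
open import Relation.Binary.PropositionalEquality using (_≡_; _≢_; refl; sym; trans; cong; subst; module ≡-Reasoning)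
open import Relation.Binary.Definitions using (tri<; tri≈; tri>)

open Equivalence using (to; from)

removeAt-linked : ∀ {xs : List ℕ} → Linked _<_ xs → (k : Fin (length xs)) → Linked _<_ (removeAt xs k)
removeAt-linked [-]         zero          = []
removeAt-linked (_ ∷ xs↑)   zero          = xs↑
removeAt-linked (_ ∷ [-])   (suc zero)    = [-]
removeAt-linked (p ∷ q ∷ l) (suc zero)    = <-trans p q ∷ l
removeAt-linked (p ∷ xs↑)   (suc (suc k)) = p ∷ removeAt-linked xs↑ (suc k)

removeAt-all : ∀ {P : ℕ → Set} {xs} → All P xs → (k : Fin (length xs)) → All P (removeAt xs k)
removeAt-all (_ ∷ pxs)  zero    = pxs
removeAt-all (px ∷ pxs) (suc k) = px ∷ removeAt-all pxs k

Comb-removeAt : ∀ {n m X} → Comb n (suc m) X → (k : Fin (length X)) → Comb n m (removeAt X k)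
Comb-removeAt {X = X} (X↑ , X∈ , len) k =
  removeAt-linked X↑ k , removeAt-all X∈ k , trans (length-removeAt X k) (cong pred len)

<ₗ-irrefl : ∀ {xs} → ¬ (xs <ₗ xs)
<ₗ-irrefl (here x<x)  = <-irrefl refl x<x
<ₗ-irrefl (there lt) = <ₗ-irrefl lt

<ₗ-asym : ∀ {xs ys} → xs <ₗ ys → ¬ (ys <ₗ xs)
<ₗ-asym (here x<y)  (here y<x)  = <-asym x<y y<x
<ₗ-asym (here x<x)  (there _)   = <-irrefl refl x<x
<ₗ-asym (there _)   (here x<x)  = <-irrefl refl x<x
<ₗ-asym (there lt)  (there gt)  = <ₗ-asym lt gt

<ₗ-removeAt : ∀ {xs} → Linked _<_ xs → ∀ {j k : Fin (length xs)} → k Fin.< j → removeAt xs j <ₗ removeAt xs k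
<ₗ-removeAt {_ ∷ _ ∷ _} (x<y ∷ _) {suc _} {zero}  _         = here x<y
<ₗ-removeAt {_ ∷ _}     xs↑       {suc _} {suc _} (s≤s k<j) = there (<ₗ-removeAt (Linked.tail xs↑) k<j)

<ₗ-removeAt⁻¹ : ∀ {xs} → Linked _<_ xs → ∀ {j k : Fin (length xs)} → removeAt xs j <ₗ removeAt xs k → k Fin.< j
<ₗ-removeAt⁻¹ xs↑ {j} {k} lt with <-cmp j k
... | tri< j<k _ _ = ⊥-elim (<ₗ-asym lt (<ₗ-removeAt xs↑ j<k))
... | tri≈ _ refl _ = ⊥-elim (<ₗ-irrefl lt)
... | tri> _ _ k<j = k<j

module PacketIndex {X : List ℕ} (X↑ : Linked _<_ X) {A : SubsetC} {P : Fin (length X) → Set}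
                   (A⇔P : ∀ j → A (removeAt X j) ⇔ P j) where

  meets⇔ : MeetsPacket A X ⇔ ∃ P
  meets⇔ = mk⇔ (λ { (_ , (j , refl) , a) → j , to (A⇔P j) a })
               (λ (j , p) → removeAt X j , (j , refl) , from (A⇔P j) p)

  notFull⇔ : NotFullPacket A X ⇔ ∃ λ j → ¬ P j
  notFull⇔ = mk⇔ (λ { (_ , (j , refl) , ¬a) → j , ¬a ∘ from (A⇔P j) })
                 (λ (j , ¬p) → removeAt X j , (j , refl) , ¬p ∘ to (A⇔P j))

  full⇔ : (∀ Y → InPacket X Y → A Y) ⇔ (∀ j → P j)
  full⇔ = mk⇔ (λ all j → to (A⇔P j) (all _ (j , refl)))
              (λ { all _ (j , refl) → from (A⇔P j) (all j) })

  suffix⇔ : IsSuffix A X ⇔ (∀ {j k} → k Fin.< j → P j → P k)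
  suffix⇔ = mk⇔
    (λ suffix {j} {k} k<j p → to (A⇔P k) (suffix _ _ (j , refl) (k , refl) (<ₗ-removeAt X↑ k<j) (from (A⇔P j) p)))
    (λ { down _ _ (j , refl) (k , refl) lt a → from (A⇔P k) (down (<ₗ-removeAt⁻¹ X↑ lt) (to (A⇔P j) a)) })

  prefix⇒ : IsPrefix A X → ∀ {j k} → k Fin.< j → P k → P j
  prefix⇒ prefix {j} {k} k<j p = to (A⇔P j) (prefix _ _ (j , refl) (k , refl) (<ₗ-removeAt X↑ k<j) (from (A⇔P k) p))

closed-both-ways : ∀ {t} {P : Fin t → Set} → (∀ {j k} → k Fin.< j → P j → P k) → (∀ {j k} → k Fin.< j → P k → P j)
                 → ∀ {i j} → P i → P j
closed-both-ways down up {i} {j} pi with <-cmp i j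
... | tri< i<j _ _ = up i<j pi
... | tri≈ _ refl _ = pi
... | tri> _ _ j<i = down j<i pi

sandwiched : ∀ β {x y z : Bool} → (x ≡ true → y ≡ true) → (y ≡ true → z ≡ true) → x ≡ β → z ≡ β → y ≡ β
sandwiched true              x⇒y _   x≡true _       = x⇒y x≡true
sandwiched false {y = false} _   _   _      _       = refl
sandwiched false {y = true}  _   y⇒z _      z≡false = contradiction (trans (sym (y⇒z refl)) z≡false) λ ()

data Kind : Set where
  full even odd : Kind

opposite : Kind → Kind
opposite full = full
opposite even = odd
opposite odd  = even

opposite-involutive : ∀ c → opposite (opposite c) ≡ c
opposite-involutive full = refl
opposite-involutive even = refl
opposite-involutive odd  = refl

opposite-injective : ∀ {c d} → opposite c ≡ opposite d → c ≡ d
opposite-injective {c} {d} eq = trans (sym (opposite-involutive c)) (trans (cong opposite eq) (opposite-involutive d))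

opposite-≢-full : ∀ {c} → c ≢ full → opposite c ≢ full
opposite-≢-full {full} c≢full = c≢full
opposite-≢-full {even} _ ()
opposite-≢-full {odd}  _ ()

≢-opposite : ∀ {c} → c ≢ full → c ≢ opposite c
≢-opposite {full} c≢full = c≢full
≢-opposite {even} _ ()
≢-opposite {odd}  _ ()

parity : ℕ → Kind
parity zero    = even
parity (suc m) = opposite (parity m)

parity-≢-full : ∀ m → parity m ≢ full
parity-≢-full zero    ()
parity-≢-full (suc m) = opposite-≢-full (parity-≢-full m)

kind-trichotomy : ∀ {w} → w ≢ full → ∀ v → v ≡ full ⊎ v ≡ w ⊎ v ≡ opposite w
kind-trichotomy {full} w≢full _    = ⊥-elim (w≢full refl)
kind-trichotomy {even} _      full = inj₁ refl
kind-trichotomy {even} _      even = inj₂ (inj₁ refl)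
kind-trichotomy {even} _      odd  = inj₂ (inj₂ refl)
kind-trichotomy {odd}  _      full = inj₁ refl
kind-trichotomy {odd}  _      odd  = inj₂ (inj₁ refl)
kind-trichotomy {odd}  _      even = inj₂ (inj₂ refl)

≢-parities⇒full : ∀ m {v} → v ≢ parity m → v ≢ parity (suc m) → v ≡ full
≢-parities⇒full m {v} v≢m v≢m+1 with kind-trichotomy (parity-≢-full m) v
... | inj₁ v≡full       = v≡full
... | inj₂ (inj₁ v≡m)   = ⊥-elim (v≢m v≡m)
... | inj₂ (inj₂ v≡m+1) = ⊥-elim (v≢m+1 v≡m+1)

extend : Bool → Kind → Kind
extend _     even = odd
extend _     odd  = even
extend true  full = full
extend false full = odd

extend-≢-full : ∀ b {c} → c ≢ full → extend b c ≡ opposite c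
extend-≢-full _ {full} c≢full = ⊥-elim (c≢full refl)
extend-≢-full _ {even} _      = refl
extend-≢-full _ {odd}  _      = refl

extend≡full⇒true : ∀ {b v} → extend b v ≡ full → b ≡ true
extend≡full⇒true {true}          _  = refl
extend≡full⇒true {false} {full}  ()
extend≡full⇒true {false} {even}  ()
extend≡full⇒true {false} {odd}   ()

extend-full-≢-even : ∀ b → extend b full ≢ even
extend-full-≢-even true  ()
extend-full-≢-even false ()

extend-full-≢-odd⇔ : ∀ b → extend b full ≢ odd ⇔ b ≡ true
extend-full-≢-odd⇔ true  = mk⇔ (λ _ → refl) (λ _ ())
extend-full-≢-odd⇔ false = mk⇔ (λ ≢odd → ⊥-elim (≢odd refl)) (λ ())

-- For c ≢ full, rank c orders the kinds as c, full, opposite c.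
rank : Kind → Kind → ℕ
rank full _    = 1
rank _    full = 1
rank even even = 0
rank odd  odd  = 0
rank _    _    = 2

rank-minimum : ∀ {c v} → c ≢ full → rank c v ≤ rank c c → v ≡ c
rank-minimum {full} c≢full _ = ⊥-elim (c≢full refl)
rank-minimum {even} {even} _ _ = refl
rank-minimum {odd}  {odd}  _ _ = refl
rank-minimum {even} {full} _ ()
rank-minimum {even} {odd}  _ ()
rank-minimum {odd}  {full} _ ()
rank-minimum {odd}  {even} _ ()

rank-maximum : ∀ {d v} → d ≢ full → rank (opposite d) d ≤ rank (opposite d) v → v ≡ d
rank-maximum {full} d≢full _ = ⊥-elim (d≢full refl)
rank-maximum {even} {even} _ _ = refl
rank-maximum {odd}  {odd}  _ _ = refl
rank-maximum {even} {full} _ (s≤s ())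
rank-maximum {even} {odd}  _ ()
rank-maximum {odd}  {full} _ (s≤s ())
rank-maximum {odd}  {even} _ ()

rank-≤-maximum : ∀ {d} → d ≢ full → ∀ v → rank (opposite d) v ≤ rank (opposite d) d
rank-≤-maximum {full} d≢full _ = ⊥-elim (d≢full refl)
rank-≤-maximum {even} _ full = s≤s z≤n
rank-≤-maximum {even} _ even = ≤-refl
rank-≤-maximum {even} _ odd  = z≤n
rank-≤-maximum {odd}  _ full = s≤s z≤n
rank-≤-maximum {odd}  _ odd  = ≤-refl
rank-≤-maximum {odd}  _ even = z≤n

rank-middle : ∀ {c v} → c ≢ full → rank c v ≤ rank c full → rank c full ≤ rank c v → v ≡ full
rank-middle {full} c≢full _ _ = ⊥-elim (c≢full refl)
rank-middle {even} {full} _ _ _ = refl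
rank-middle {odd}  {full} _ _ _ = refl
rank-middle {even} {even} _ _ ()
rank-middle {even} {odd}  _ (s≤s ()) _
rank-middle {odd}  {odd}  _ _ ()
rank-middle {odd}  {even} _ (s≤s ()) _

extend-monotone : ∀ {c v w} b → c ≢ full → rank c v ≤ rank c w → rank (opposite c) (extend b v) ≤ rank (opposite c) (extend b w)
extend-monotone {full} _ c≢full _ = ⊥-elim (c≢full refl)
extend-monotone {even} {even}        _ _ _        = z≤n
extend-monotone {even} {full} {full} _ _ _        = ≤-refl
extend-monotone {even} {full} {odd}  b _ _        = rank-≤-maximum (λ ()) (extend b full)
extend-monotone {even} {odd}  {odd}  _ _ _        = ≤-refl
extend-monotone {even} {full} {even} _ _ ()
extend-monotone {even} {odd}  {full} _ _ (s≤s ())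
extend-monotone {even} {odd}  {even} _ _ ()
extend-monotone {odd}  {odd}         _ _ _        = z≤n
extend-monotone {odd}  {full} {full} _ _ _        = ≤-refl
extend-monotone {odd}  {full} {even} b _ _        = rank-≤-maximum (λ ()) (extend b full)
extend-monotone {odd}  {even} {even} _ _ _        = ≤-refl
extend-monotone {odd}  {full} {odd}  _ _ ()
extend-monotone {odd}  {even} {full} _ _ (s≤s ())
extend-monotone {odd}  {even} {odd}  _ _ ()

-- Compares the members of the packet of x ∷ y ∷ y′ ∷ V lacking y′ or a later element with the one
-- lacking y (see consPacket); this is where transitivity of the complement of J is needed.
extend-monotone-head : ∀ a b b′ {u v} → extend a u ≢ full → (b ≡ false → a ≡ false → b′ ≡ false)
  → rank (extend a u) v ≤ rank (extend a u) u
  → rank (opposite (extend a u)) (extend b v) ≤ rank (opposite (extend a u)) (extend b′ u)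
extend-monotone-head true  _     _     {full}        c≢full _ _ = ⊥-elim (c≢full refl)
extend-monotone-head false b     false {full} {v}    _ _ _      = rank-≤-maximum (λ ()) (extend b v)
extend-monotone-head false true  true  {full} {full} _ _ _      = ≤-refl
extend-monotone-head false true  true  {full} {odd}  _ _ _      = z≤n
extend-monotone-head false true  true  {full} {even} _ _ (s≤s ())
extend-monotone-head false false true  {full}        _ tr _     = contradiction (tr refl refl) λ ()
extend-monotone-head _     b     _     {even} {v}    _ _ v≤u    = extend-monotone {odd} {v} {even} b (λ ()) v≤u
extend-monotone-head _     b     _     {odd}  {v}    _ _ v≤u    = extend-monotone {even} {v} {odd} b (λ ()) v≤u

-- The kinds f j of the packet of a t-set of kind c, where f j is the kind of the member lacking the
-- j-th element; in lexicographic order (decreasing j) they run through c, full, opposite c.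
record Profile (c : Kind) (t : ℕ) (f : Fin t → Kind) : Set where
  field
    full⇒all-full : c ≡ full → ∀ j → f j ≡ full
    antitone      : ∀ {j k} → k Fin.< j → rank c (f j) ≤ rank c (f k)
    some-≢        : c ≢ full → ∃ λ j → f j ≢ c
    parity⇒some-≡ : c ≡ parity t → ∃ λ j → f j ≡ c

open Profile

Profile-cong : ∀ {c t} {f g : Fin t → Kind} → (∀ j → f j ≡ g j) → Profile c t f → Profile c t g
Profile-cong {c} f≗g P = record
  { full⇒all-full = λ c≡full j → trans (sym (f≗g j)) (full⇒all-full P c≡full j)
  ; antitone      = λ {j} {k} k<j → subst (λ v → rank c v ≤ rank c _) (f≗g j)
                                      (subst (λ v → rank c _ ≤ rank c v) (f≗g k) (antitone P k<j))
  ; some-≢        = λ c≢full → let (j , fj≢c) = some-≢ P c≢full in j , fj≢c ∘ trans (f≗g j)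
  ; parity⇒some-≡ = λ c≡ → let (j , fj≡c) = parity⇒some-≡ P c≡ in j , trans (sym (f≗g j)) fj≡c
  }

all-full-profile : ∀ {t} {f : Fin t → Kind} → (∀ j → f j ≡ full) → Profile full t f
all-full-profile {t} all-full = record
  { full⇒all-full = λ _ → all-full
  ; antitone      = λ _ → ≤-refl
  ; some-≢        = λ full≢full → ⊥-elim (full≢full refl)
  ; parity⇒some-≡ = λ full≡ → ⊥-elim (parity-≢-full t (sym full≡))
  }

pair-profile : ∀ b {f : Fin 2 → Kind} → (∀ j → f j ≡ full) → Profile (extend b full) 2 f
pair-profile true  all-full = all-full-profile all-full
pair-profile false {f} all-full = record
  { full⇒all-full = λ ()
  ; antitone      = λ {j} {k} _ → subst (λ v → rank odd v ≤ rank odd (f k)) (sym (all-full j))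
                                    (subst (λ v → 1 ≤ rank odd v) (sym (all-full k)) ≤-refl)
  ; some-≢        = λ _ → zero , λ f0≡odd → contradiction (trans (sym (all-full zero)) f0≡odd) λ ()
  ; parity⇒some-≡ = λ ()
  }

-- The packet of x ∷ y ∷ y′ ∷ V in terms of that of y ∷ y′ ∷ V (given by f′), where a, b, b′
-- say whether yy′, xy, xy′ lie in J and u is the kind of y′ ∷ V.
consPacket : ∀ {t} → Bool → Bool → Bool → Kind → (Fin (suc t) → Kind) → Fin (suc (suc t)) → Kind
consPacket a _ _  u _  zero          = extend a u
consPacket _ _ b′ u _  (suc zero)    = extend b′ u
consPacket _ b _  _ f′ (suc (suc j)) = extend b (f′ (suc j))

profile-cons-full : ∀ {t} b b′ (f′ : Fin (suc (suc t)) → Kind) → (b ≡ true → b′ ≡ true)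
  → Profile full (suc (suc t)) f′ → Profile (extend b full) (suc (suc (suc t))) (consPacket true b b′ full f′)
profile-cons-full true b′ f′ b⇒b′ P = all-full-profile λ
  { zero          → refl
  ; (suc zero)    → cong (λ b → extend b full) (b⇒b′ refl)
  ; (suc (suc j)) → cong (extend true) (full⇒all-full P refl (suc j))
  }
profile-cons-full false b′ f′ _ P = record
  { full⇒all-full = λ ()
  ; antitone      = antitone′
  ; some-≢        = λ _ → zero , λ ()
  ; parity⇒some-≡ = λ _ → suc (suc zero) , cong (extend false) (full⇒all-full P refl (suc zero))
  }
  where
  head-rank : ∀ b → rank odd (extend b full) ≤ 1
  head-rank true  = ≤-refl
  head-rank false = z≤n

  antitone′ : ∀ {j k} → k Fin.< j → rank odd (consPacket true false b′ full f′ j) ≤ rank odd (consPacket true false b′ full f′ k)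
  antitone′ {suc (suc j)} _ rewrite full⇒all-full P refl (suc j) = z≤n
  antitone′ {suc zero} {zero}  _        = head-rank b′
  antitone′ {suc zero} {suc _} (s≤s ())

profile-cons-defect : ∀ {t} a b b′ u (f′ : Fin (suc (suc t)) → Kind) → f′ zero ≡ u → extend a u ≢ full
  → (b ≡ false → a ≡ false → b′ ≡ false) → Profile (extend a u) (suc (suc t)) f′
  → Profile (opposite (extend a u)) (suc (suc (suc t))) (consPacket a b b′ u f′)
profile-cons-defect {t} a b b′ u f′ f′0≡u c′≢full tr P = record
  { full⇒all-full = λ c≡full → ⊥-elim (opposite-≢-full c′≢full c≡full)
  ; antitone      = antitone′
  ; some-≢        = λ _ → zero , ≢-opposite c′≢full
  ; parity⇒some-≡ = some-≡
  }
  where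
  c′ : Kind
  c′ = extend a u

  f : Fin (suc (suc (suc t))) → Kind
  f = consPacket a b b′ u f′

  antitone′ : ∀ {j k} → k Fin.< j → rank (opposite c′) (f j) ≤ rank (opposite c′) (f k)
  antitone′ {suc j}       {zero}        _         = rank-≤-maximum c′≢full (f (suc j))
  antitone′ {suc (suc j)} {suc zero}    _         = extend-monotone-head a b b′ c′≢full tr
    (subst (λ v → rank c′ (f′ (suc j)) ≤ rank c′ v) f′0≡u (antitone P (s≤s z≤n)))
  antitone′ {suc (suc j)} {suc (suc k)} (s≤s k<j) = extend-monotone b c′≢full (antitone P k<j)
  antitone′ {suc zero}    {suc _}       (s≤s ())

  some-≡ : opposite c′ ≡ parity (suc (suc (suc t))) → ∃ λ j → f j ≡ opposite c′
  some-≡ eq with parity⇒some-≡ P (opposite-injective eq)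
  ... | zero  , f′0≡c′ = suc zero , trans (cong (extend b′) (trans (sym f′0≡u) f′0≡c′)) (extend-≢-full b′ c′≢full)
  ... | suc j , f′j≡c′ = suc (suc j) , trans (cong (extend b) f′j≡c′) (extend-≢-full b c′≢full)

profile-cons : ∀ {t} a b b′ u (f′ : Fin (suc (suc t)) → Kind) → f′ zero ≡ u → (∀ β → b ≡ β → a ≡ β → b′ ≡ β)
  → Profile (extend a u) (suc (suc t)) f′
  → Profile (extend b (extend a u)) (suc (suc (suc t))) (consPacket a b b′ u f′)
profile-cons true  b b′ full f′ _    tr = profile-cons-full b b′ f′ (λ b≡true → tr true b≡true refl)
profile-cons false b b′ full f′ f′0≡u tr = profile-cons-defect false b b′ full f′ f′0≡u (λ ()) (tr false)
profile-cons a     b b′ even f′ f′0≡u tr = profile-cons-defect a b b′ even f′ f′0≡u (λ ()) (tr false)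
profile-cons a     b b′ odd  f′ f′0≡u tr = profile-cons-defect a b b′ odd f′ f′0≡u (λ ()) (tr false)

≢-self-downward : ∀ {c t} {f : Fin t → Kind} → Profile c t f → c ≢ full → ∀ {j k} → k Fin.< j → f j ≢ c → f k ≢ c
≢-self-downward {c} {f = f} P c≢full {j} k<j fj≢c fk≡c =
  fj≢c (rank-minimum c≢full (subst (λ v → rank c (f j) ≤ rank c v) fk≡c (antitone P k<j)))

≢-opposite-upward : ∀ {d t} {f : Fin t → Kind} → Profile (opposite d) t f → d ≢ full → ∀ {j k} → k Fin.< j → f k ≢ d → f j ≢ d
≢-opposite-upward {d} {f = f} P d≢full {k = k} k<j fk≢d fj≡d =
  fk≢d (rank-maximum d≢full (subst (λ v → rank (opposite d) v ≤ rank (opposite d) (f k)) fj≡d (antitone P k<j)))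

full-between-defect : ∀ {c t} {f : Fin t → Kind} → c ≢ full → Profile c t f → ∀ {i j k} → k Fin.< j → j Fin.< i
                    → f j ≡ full → f i ≡ f k → f i ≡ full
full-between-defect {c} {f = f} c≢full P {i} {j} {k} k<j j<i fj≡full fi≡fk = rank-middle c≢full
  (subst (λ v → rank c (f i) ≤ rank c v) fj≡full (antitone P j<i))
  (subst (λ v → rank c v ≤ rank c (f i)) fj≡full (subst (λ v → rank c (f j) ≤ rank c v) (sym fi≡fk) (antitone P k<j)))

full-between : ∀ {c t} {f : Fin t → Kind} → Profile c t f → ∀ {i j k} → k Fin.< j → j Fin.< i
             → f j ≡ full → f i ≡ f k → f i ≡ full
full-between {full} P _ _ _ _ = full⇒all-full P refl _
full-between {even} P         = full-between-defect (λ ()) P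
full-between {odd}  P         = full-between-defect (λ ()) P

SuffixPattern : ∀ {t} → (Fin t → Kind) → Kind → Set
SuffixPattern f d = (∃ λ j → f j ≢ d) × (∃ λ j → ¬ f j ≢ d) × (∀ {j k} → k Fin.< j → f j ≢ d → f k ≢ d)

suffix-pattern⇔ : ∀ {c t d} {f : Fin t → Kind} → Profile c t f → d ≡ parity t → SuffixPattern f d ⇔ c ≡ d
suffix-pattern⇔ {c} {t} {d} {f} P d≡parity = mk⇔ pattern⇒ ⇒pattern
  where
  d≢full : d ≢ full
  d≢full d≡full = parity-≢-full t (trans (sym d≡parity) d≡full)

  pattern⇒ : SuffixPattern f d → c ≡ d
  pattern⇒ ((i , fi≢d) , (j , ¬fj≢d) , down) with kind-trichotomy d≢full c
  ... | inj₁ refl        = ⊥-elim (¬fj≢d (λ fj≡d → d≢full (trans (sym fj≡d) (full⇒all-full P refl j))))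
  ... | inj₂ (inj₁ c≡d) = c≡d
  ... | inj₂ (inj₂ refl) = ⊥-elim (¬fj≢d (closed-both-ways down (≢-opposite-upward P d≢full) fi≢d))

  ⇒pattern : c ≡ d → SuffixPattern f d
  ⇒pattern refl = some-≢ P d≢full , map₂ contradiction (parity⇒some-≡ P d≡parity) , ≢-self-downward P d≢full

module Kinds (n : ℕ) (J : List ℕ → Bool) where

  pairJ : ℕ → ℕ → Bool
  pairJ a b = J (a ∷ b ∷ [])

  PairTransitive : Set
  PairTransitive = ∀ β {a b c} → Comb n 3 (a ∷ b ∷ c ∷ []) → pairJ a b ≡ β → pairJ b c ≡ β → pairJ a c ≡ β

  realizable⇒pairTransitive : Realizable n J → PairTransitive
  realizable⇒pairTransitive realizable β {a} {b} {c} cX ab≡β bc≡β = [ from-prefix , from-suffix ]′ (realizable _ cX)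
    where
    X : List ℕ
    X = a ∷ b ∷ c ∷ []

    inJ : Fin 3 → Set
    inJ j = J (removeAt X j) ≡ true

    JSet⇔inJ : ∀ j → JSet n J (removeAt X j) ⇔ inJ j
    JSet⇔inJ j = mk⇔ proj₂ (Comb-removeAt cX j ,_)

    open PacketIndex (proj₁ cX) {JSet n J} JSet⇔inJ

    from-prefix : IsPrefix (JSet n J) X → pairJ a c ≡ β
    from-prefix prefix = sandwiched β (prefix⇒ prefix {suc zero} {zero} (s≤s z≤n))
                                      (prefix⇒ prefix {suc (suc zero)} {suc zero} (s≤s (s≤s z≤n))) bc≡β ab≡β

    from-suffix : IsSuffix (JSet n J) X → pairJ a c ≡ β
    from-suffix suffix = sandwiched β (to suffix⇔ suffix {suc (suc zero)} {suc zero} (s≤s (s≤s z≤n)))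
                                      (to suffix⇔ suffix {suc zero} {zero} (s≤s z≤n)) ab≡β bc≡β

  -- kind W is full if every consecutive pair of W lies in J, and otherwise the parity of the
  -- position (counted from 1) of the last consecutive pair outside J.
  kind : List ℕ → Kind
  kind (x ∷ y ∷ W) = extend (pairJ x y) (kind (y ∷ W))
  kind _           = full

  all-full⇒full : ∀ {W} → 3 ≤ length W → (∀ j → kind (removeAt W j) ≡ full) → kind W ≡ full
  all-full⇒full {x ∷ y ∷ y′ ∷ V} _ all-full = begin
    extend (pairJ x y) (kind (y ∷ y′ ∷ V)) ≡⟨ cong (extend (pairJ x y)) (all-full zero) ⟩
    extend (pairJ x y) full                ≡⟨ cong (λ b → extend b full) (extend≡full⇒true (all-full (suc (suc zero)))) ⟩
    full                                   ∎
    where open ≡-Reasoning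
  all-full⇒full {[]}          ()
  all-full⇒full {_ ∷ []}      (s≤s ())
  all-full⇒full {_ ∷ _ ∷ []}  (s≤s (s≤s ()))

  module Transitive (transJ : PairTransitive) where

    packet-profile : ∀ {W} → Linked _<_ W → All (λ x → 1 ≤ x × x ≤ n) W
                   → Profile (kind W) (length W) (λ j → kind (removeAt W j))
    packet-profile {[]}         _ _ = all-full-profile λ ()
    packet-profile {_ ∷ []}     _ _ = all-full-profile λ { zero → refl }
    packet-profile {x ∷ y ∷ []} _ _ = pair-profile (pairJ x y) λ { zero → refl ; (suc zero) → refl }
    packet-profile {x ∷ y ∷ y′ ∷ V} (x<y ∷ y↑) (x∈ ∷ y∈ ∷ y′∈ ∷ V∈) =
      Profile-cong (λ { zero → refl ; (suc zero) → refl ; (suc (suc _)) → refl })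
        (profile-cons (pairJ y y′) (pairJ x y) (pairJ x y′) (kind (y′ ∷ V)) _ refl
          (λ β → transJ β ((x<y ∷ Linked.head y↑ ∷ [-]) , (x∈ ∷ y∈ ∷ y′∈ ∷ []) , refl))
          (packet-profile y↑ (y∈ ∷ y′∈ ∷ V∈)))

    KindCriterion : ℕ → Set
    KindCriterion k = ∀ {W} → Comb n (2 + k) W
      → (Lˢ n J (2 + k) W ⇔ kind W ≡ parity (2 + k)) × (Mˢ n J (2 + k) W ⇔ kind W ≢ parity (3 + k))

    kind-criterion-zero : KindCriterion 0
    kind-criterion-zero {a ∷ b ∷ []} cW =
      mk⇔ (λ ()) (extend-full-≢-even (pairJ a b)) ,
      mk⇔ (from (extend-full-≢-odd⇔ (pairJ a b)) ∘ proj₂) (λ ≢odd → cW , to (extend-full-≢-odd⇔ (pairJ a b)) ≢odd)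
    kind-criterion-zero {[]}              (_ , _ , ())
    kind-criterion-zero {_ ∷ []}          (_ , _ , ())
    kind-criterion-zero {_ ∷ _ ∷ _ ∷ _}   (_ , _ , ())

    module Packet {k} (criterion : KindCriterion k) {X} (cX : Comb n (3 + k) X) where

      profile : Profile (kind X) (length X) (λ j → kind (removeAt X j))
      profile = packet-profile (proj₁ cX) (proj₁ (proj₂ cX))

      parity-length : parity (3 + k) ≡ parity (length X)
      parity-length = cong parity (sym (proj₂ (proj₂ cX)))

      L⇔ : ∀ j → Lˢ n J (2 + k) (removeAt X j) ⇔ kind (removeAt X j) ≡ parity (2 + k)
      L⇔ j = proj₁ (criterion (Comb-removeAt cX j))

      M⇔ : ∀ j → Mˢ n J (2 + k) (removeAt X j) ⇔ kind (removeAt X j) ≢ parity (3 + k)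
      M⇔ j = proj₂ (criterion (Comb-removeAt cX j))

      M∖L : SubsetC
      M∖L Y = Mˢ n J (2 + k) Y × ¬ Lˢ n J (2 + k) Y

      M∖L⇔ : ∀ j → M∖L (removeAt X j) ⇔ kind (removeAt X j) ≡ full
      M∖L⇔ j = mk⇔
        (λ (inM , ∉L) → ≢-parities⇒full (2 + k) (∉L ∘ from (L⇔ j)) (to (M⇔ j) inM))
        (λ ≡full → from (M⇔ j) (λ ≡3+k → parity-≢-full (3 + k) (trans (sym ≡3+k) ≡full))
                 , λ inL → parity-≢-full (2 + k) (trans (sym (to (L⇔ j) inL)) ≡full))

      module L = PacketIndex (proj₁ cX) {Lˢ n J (2 + k)} L⇔
      module M = PacketIndex (proj₁ cX) {Mˢ n J (2 + k)} M⇔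
      module M∖L = PacketIndex (proj₁ cX) {M∖L} M∖L⇔

      meets-L∧all-M⇒parity : MeetsPacket (Lˢ n J (2 + k)) X → (∀ Y → InPacket X Y → Mˢ n J (2 + k) Y)
                           → kind X ≡ parity (2 + k)
      meets-L∧all-M⇒parity meetsL allM with kind-trichotomy (parity-≢-full (2 + k)) (kind X)
      ... | inj₁ ≡full = let (j , fj≡2+k) = to L.meets⇔ meetsL in
        ⊥-elim (parity-≢-full (2 + k) (trans (sym fj≡2+k) (full⇒all-full profile ≡full j)))
      ... | inj₂ (inj₁ ≡2+k) = ≡2+k
      ... | inj₂ (inj₂ ≡3+k) = let (j , fj≡) = parity⇒some-≡ profile (trans ≡3+k parity-length) in
        ⊥-elim (to M.full⇔ allM j (trans fj≡ ≡3+k))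

      all-M∖L⇒full : (∀ Y → InPacket X Y → M∖L Y) → kind X ≡ full
      all-M∖L⇒full allM∖L = all-full⇒full {X} (subst (3 ≤_) (sym (proj₂ (proj₂ cX))) (m≤m+n 3 k)) (to M∖L.full⇔ allM∖L)

      M-prefix⇒parity : (Mˢ n J (2 + k) ₚ[ n , 2 + k ]) X → kind X ≡ parity (2 + k)
      M-prefix⇒parity (_ , meets , notFull , prefix)
        with kind-trichotomy (parity-≢-full (2 + k)) (kind X) | to M.meets⇔ meets | to M.notFull⇔ notFull
      ... | inj₁ ≡full | _ | j , ¬fj≢3+k =
        ⊥-elim (¬fj≢3+k (λ fj≡3+k → parity-≢-full (3 + k) (trans (sym fj≡3+k) (full⇒all-full profile ≡full j))))
      ... | inj₂ (inj₁ ≡2+k) | _ | _ = ≡2+k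
      ... | inj₂ (inj₂ ≡3+k) | i , fi≢3+k | _ , ¬fj≢3+k =
        ⊥-elim (¬fj≢3+k (closed-both-ways (≢-self-downward (subst (λ c → Profile c _ _) ≡3+k profile) (parity-≢-full (3 + k)))
                                          (M.prefix⇒ prefix) fi≢3+k))

    kind-criterion-suc : ∀ {k} → KindCriterion k → KindCriterion (suc k)
    kind-criterion-suc {k} criterion {X} cX = L-criterion , M-criterion
      where
      open Packet criterion cX

      cX′ : Comb n (suc (k + 2)) X
      cX′ = subst (λ m → Comb n (suc m) X) (+-comm 2 k) cX

      L-criterion : Lˢ n J (3 + k) X ⇔ kind X ≡ parity (3 + k)
      L-criterion = mk⇔
        (λ (_ , meets , notFull , suffix) →
           to (suffix-pattern⇔ profile parity-length) (to M.meets⇔ meets , to M.notFull⇔ notFull , to M.suffix⇔ suffix))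
        (λ ≡3+k → let (meets , notFull , suffix) = from (suffix-pattern⇔ profile parity-length) ≡3+k in
           cX′ , from M.meets⇔ meets , from M.notFull⇔ notFull , from M.suffix⇔ suffix)

      inM⇒ : Mˢ n J (3 + k) X → kind X ≢ parity (4 + k)
      inM⇒ (inj₁ inL)          ≡4+k = ≢-opposite (parity-≢-full (3 + k)) (trans (sym (to L-criterion inL)) ≡4+k)
      inM⇒ (inj₂ (_ , allM∖L)) ≡4+k = parity-≢-full (4 + k) (trans (sym ≡4+k) (all-M∖L⇒full allM∖L))

      ⇒inM : kind X ≢ parity (4 + k) → Mˢ n J (3 + k) X
      ⇒inM ≢4+k with kind-trichotomy (parity-≢-full (3 + k)) (kind X)
      ... | inj₁ ≡full        = inj₂ (cX′ , from M∖L.full⇔ (full⇒all-full profile ≡full))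
      ... | inj₂ (inj₁ ≡3+k) = inj₁ (from L-criterion ≡3+k)
      ... | inj₂ (inj₂ ≡4+k) = ⊥-elim (≢4+k ≡4+k)

      M-criterion : Mˢ n J (3 + k) X ⇔ kind X ≢ parity (4 + k)
      M-criterion = mk⇔ inM⇒ ⇒inM

    kind-criterion : ∀ k → KindCriterion k
    kind-criterion zero    = kind-criterion-zero
    kind-criterion (suc k) = kind-criterion-suc (kind-criterion k)

lemma4p16 : (n : ℕ) (J : List ℕ → Bool) → Realizable n J →
    (i : ℕ) → 2 ≤ i → i ≤ n ∸ 1 →
    ¬ (∃ λ Y → Comb n (i + 2) Y ×
      let A = λ Z → InPacket Y Z × (Lˢ n J i ₚ[ n , i ]) Z × (Mˢ n J i F[ n , i ]) Z
          B = λ Z → InPacket Y Z × (Lˢ n J i ∅[ n , i ]) Z × (Mˢ n J i F[ n , i ]) Z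
          C = λ Z → InPacket Y Z × (Lˢ n J i ∅[ n , i ]) Z × (Mˢ n J i ₚ[ n , i ]) Z
      in (∀ Z → InPacket Y Z → A Z ⊎ B Z ⊎ C Z)
         × (∃ λ Z → A Z) × (∃ λ Z → B Z) × (∃ λ Z → C Z)
         × (∀ Z W → A Z → B W → Z <ₗ W)
         × (∀ Z W → B Z → C W → Z <ₗ W))
lemma4p16 n J realizable (suc (suc k)) _ _
  (Y , cY , _ , (_ , inA@((jA , refl) , (cA , meetsL , _) , (_ , allM-A)))
              , (_ , inB@((jB , refl) , (cB , noL) , (_ , allM-B)))
              , (_ , inC@((jC , refl) , _ , M-prefix))
              , A<B , B<C) =
  parity-≢-full (2 + k) (trans (sym kind-A) (full-between profile jC<jB jB<jA kind-B (trans kind-A (sym kind-C))))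
  where
  open Kinds n J
  open Transitive (realizable⇒pairTransitive realizable)

  profile : Profile (kind Y) (length Y) (λ j → kind (removeAt Y j))
  profile = packet-profile (proj₁ cY) (proj₁ (proj₂ cY))

  jB<jA : jB Fin.< jA
  jB<jA = <ₗ-removeAt⁻¹ (proj₁ cY) (A<B _ _ inA inB)

  jC<jB : jC Fin.< jB
  jC<jB = <ₗ-removeAt⁻¹ (proj₁ cY) (B<C _ _ inB inC)

  kind-A : kind (removeAt Y jA) ≡ parity (2 + k)
  kind-A = Packet.meets-L∧all-M⇒parity (kind-criterion k) cA meetsL allM-A

  kind-B : kind (removeAt Y jB) ≡ full
  kind-B = Packet.all-M∖L⇒full (kind-criterion k) cB (λ Z Z∈ → allM-B Z Z∈ , noL Z Z∈)

  kind-C : kind (removeAt Y jC) ≡ parity (2 + k)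
  kind-C = Packet.M-prefix⇒parity (kind-criterion k) (proj₁ M-prefix) M-prefix
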